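{- Let $l$ be a complete distributive lattice, $\Sigma$ a finite alphabet and $f:\Sigma^{\omega}\to l$. The following are equivalent: (1) $f=L_\omega(\mathcal A)$ for some $l$-valued Büchi automaton $\mathcal A$; (2) $\mathrm{Im}(f)$ is finite and for every $a\in\mathrm{Im}(f)$ the set $f_a=\{w\in\Sigma^{\omega}:f(w)\ge a\}$ is an $\omega$-regular language over $\Sigma$; (3) there exist finitely many $m_1,\ldots,m_k\in l$ and $\omega$-regular languages $\mathcal L_1,\ldots,\mathcal L_k\subseteq\Sigma^{\omega}$ such that $f=\bigcup_{i=1}^k m_i\wedge\mathcal L_i$, i.e. $f(w)=\bigvee\{m_i: w\in\mathcal L_i\}$ for all $w$.
   Context: An $l$-valued Büchi automaton is $\mathcal A=(Q,\Sigma,\delta,I,F)$ with finite $Q$, $\delta:Q\times\Sigma\times Q\to l$, $I,F:Q\to l$; for $w=\sigma_1\sigma_2\cdots$, $L_\omega(\mathcal A)(w)=\bigvee\{I(q_0)\wedge\bigwedge_{i\ge0}\delta(q_i,\sigma_{i+1},q_{i+1})\wedge\bigwedge_{j\in J}F(q_j):q_0,q_1,\ldots\in Q,\ J\subseteq\mathbb N\text{ infinite}\}$. For $m\in l$ and $\mathcal L\subseteq\Sigma^\omega$, $m\wedge\mathcal L$ is the map with value $m$ on $\mathcal L$ and $0$ elsewhere; $\omega$-regular means accepted by a classical Büchi automaton. -}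

module Defs where

open import Level using (Level; _⊔_; Lift; lift) renaming (suc to lsuc; zero to lzero)
open import Data.Nat using (ℕ; suc) renaming (_≤_ to _≤ℕ_)
open import Data.Fin using (Fin)
open import Data.Bool using (Bool; T)
open import Data.Product using (Σ; ∃; _×_; _,_)
open import Data.List using (List)
open import Data.List.Relation.Unary.Any using (Any)
open import Relation.Binary.Lattice.Bundles using (DistributiveLattice)

record CompleteDistributiveLattice c ℓ₁ ℓ₂ : Set (lsuc (c ⊔ ℓ₁ ⊔ ℓ₂)) where
  field
    distributiveLattice : DistributiveLattice c ℓ₁ ℓ₂
  open DistributiveLattice distributiveLattice public
  field
    ⋁       : {I : Set c} → (I → Carrier) → Carrier
    ⋁-upper : {I : Set c} (g : I → Carrier) (i : I) → g i ≤ ⋁ g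
    ⋁-least : {I : Set c} (g : I → Carrier) (x : Carrier) → (∀ i → g i ≤ x) → ⋁ g ≤ x
    ⋀       : {I : Set c} → (I → Carrier) → Carrier
    ⋀-lower : {I : Set c} (g : I → Carrier) (i : I) → ⋀ g ≤ g i
    ⋀-great : {I : Set c} (g : I → Carrier) (x : Carrier) → (∀ i → x ≤ g i) → x ≤ ⋀ g

-- The finite alphabet Σ is Fin s; infinite words w = σ₁σ₂⋯ with w i = σ_{i+1}.
Word : ℕ → Set
Word s = ℕ → Fin s

InfiniteSet : (ℕ → Bool) → Set
InfiniteSet J = ∀ m → ∃ λ j → m ≤ℕ j × T (J j)

record Buchi (s : ℕ) : Set₁ where
  field
    n  : ℕ
    δ  : Fin n → Fin s → Fin n → Set
    I  : Fin n → Set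
    F  : Fin n → Set

Accepts : ∀ {s} → Buchi s → Word s → Set
Accepts {s} B w =
  Σ (ℕ → Fin n) λ q → I (q 0) × (∀ i → δ (q i) (w i) (q (suc i)))
    × (∀ m → ∃ λ j → m ≤ℕ j × F (q j))
  where open Buchi B

OmegaRegular : ∀ {ℓ} {s : ℕ} → (Word s → Set ℓ) → Set (lsuc lzero ⊔ ℓ)
OmegaRegular {s = s} P =
  Σ (Buchi s) λ B → ∀ w → (P w → Accepts B w) × (Accepts B w → P w)

module _ {c ℓ₁ ℓ₂} (L : CompleteDistributiveLattice c ℓ₁ ℓ₂) where
  open CompleteDistributiveLattice L

  record LBuchi (s : ℕ) : Set c where
    field
      n  : ℕ
      δ  : Fin n → Fin s → Fin n → Carrier
      I  : Fin n → Carrier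
      F  : Fin n → Carrier

  Lω : ∀ {s} → LBuchi s → Word s → Carrier
  Lω A w =
    ⋁ {I = Lift c (Σ (ℕ → Fin n) λ q → Σ (ℕ → Bool) InfiniteSet)}
      λ { (lift (q , J , _)) →
            I (q 0)
            ∧ (⋀ {I = Lift c ℕ} (λ { (lift i) → δ (q i) (w i) (q (suc i)) })
            ∧ ⋀ {I = Lift c (Σ ℕ λ j → T (J j))} (λ { (lift (j , _)) → F (q j) })) }
    where open LBuchi A

  Cond1 : ∀ {s} → (Word s → Carrier) → Set (c ⊔ ℓ₁)
  Cond1 {s} f = Σ (LBuchi s) λ A → ∀ w → f w ≈ Lω A w

  Cond2 : ∀ {s} → (Word s → Carrier) → Set (lsuc lzero ⊔ c ⊔ ℓ₁ ⊔ ℓ₂)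
  Cond2 {s} f =
    (Σ (List Carrier) λ xs → ∀ w → Any (λ x → f w ≈ x) xs)
    × (∀ (w₀ : Word s) → OmegaRegular (λ w → f w₀ ≤ f w))

  Cond3 : ∀ {s} → (Word s → Carrier) → Set (lsuc lzero ⊔ c ⊔ ℓ₁)
  Cond3 {s} f =
    Σ ℕ λ k → Σ (Fin k → Carrier) λ m → Σ (Fin k → Word s → Set) λ Ls →
      (∀ i → OmegaRegular (Ls i))
      × (∀ w → f w ≈ ⋁ {I = Lift c (Σ (Fin k) λ i → Ls i w)} (λ { (lift (i , _)) → m i }))

-- (1) ⇒ (3): the value of a run is the meet of the finitely many weights it
-- uses, hence equal to the meet of some subset of the weights of 𝒜.  For each
-- such meet a, the runs of value ≥ a are the accepting runs of the classical
-- threshold automaton with the transitions, initial and final states of weight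
-- ≥ a, so L_ω(𝒜) = ⋁_a a ∧ L(𝒜_{≥a}).
-- (3) ⇒ (2): f(w) only depends on the set S(w) of indices i with w ∈ 𝓛ᵢ, so f
-- has finitely many values, and f(w) ≥ a iff w ∈ ⋂_{i∈S} 𝓛ᵢ for some S with
-- ⋁_{i∈S} mᵢ ≥ a, a finite union of finite intersections of ω-regular
-- languages.
-- (2) ⇒ (3): use the languages f_x for the finitely many values x of f.
-- (3) ⇒ (1): m ∧ 𝓛 is the behaviour of a Büchi automaton for 𝓛 with its
-- transitions, initial and final states weighted m and all others ⊥, and a
-- finite join of behaviours is the behaviour of the disjoint sum.

module Submission where

open import Defs
open import Level using (Lift; lift; lower)
open import Function using (id; _∘_; _↔_; Inverse; _⇔_; mk⇔; Equivalence; case_of_)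
open import Function.Construct.Composition using (_↔-∘_)
open import Function.Construct.Identity using (↔-id)
open import Data.Nat using (ℕ; zero; suc; _+_; _≤′_; ≤′-refl; ≤′-step) renaming (_≤_ to _≤ℕ_)
open import Data.Nat.Properties using (≤-refl; ≤-trans; n≤1+n; ≤′⇒≤; ≤⇒≤′)
open import Data.Fin using (Fin; splitAt; _↑ˡ_; _↑ʳ_) renaming (zero to fzero; suc to fsuc)
open import Data.Fin.Properties using (+↔⊎; *↔×; 2↔Bool; ∀-cons; splitAt-↑ˡ; splitAt-↑ʳ)
open import Data.Fin.Subset using (Subset) renaming (_∈_ to _∈ₛ_)
open import Data.Fin.Subset.Properties using () renaming (_∈?_ to _∈ₛ?_)
open import Data.Bool using (Bool; true; false; T)
open import Data.Unit using (⊤; tt)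
open import Data.Empty using (⊥; ⊥-elim)
open import Data.Sum as Sum using (_⊎_; inj₁; inj₂; [_,_]; fromInj₁; fromInj₂)
open import Data.Product as Product using (Σ; ∃; _×_; _,_; proj₁; proj₂; uncurry)
open import Data.Product.Function.NonDependent.Propositional using (_×-↔_)
open import Data.List as List
  using (List; []; _∷_; _++_; cartesianProductWith; cartesianProduct; allFin)
open import Data.List.Membership.Propositional using (_∈_; lose)
open import Data.List.Membership.Propositional.Properties
  using (∈-map⁺; ∈-++⁺ˡ; ∈-++⁺ʳ; ∈-allFin; ∈-cartesianProductWith⁺; ∈-cartesianProduct⁺)
open import Data.List.Relation.Unary.Any as Any using (Any; here; there)
open import Data.List.Relation.Unary.Any.Properties using (lookup-index)
open import Data.Vec using ([]; _∷_; tabulate)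
open import Data.Vec.Properties using (lookup∘tabulate; []=⇒lookup; lookup⇒[]=)
open import Relation.Nullary using (Dec; yes; no; ¬_)
open import Relation.Nullary.Decidable
  using (isYes; isNo; does; True; toWitness; fromWitness; dec-true; decidable-stable)
open import Relation.Binary.PropositionalEquality
  using (_≡_; refl; sym; trans; cong; cong₂; subst; subst₂)
open import Axiom.ExcludedMiddle using (ExcludedMiddle)

-- Büchi automata over arbitrary state sets

InfinitelyOften : ∀ {ℓ} → (ℕ → Set ℓ) → Set ℓ
InfinitelyOften P = ∀ m → ∃ λ j → m ≤ℕ j × P j

record BuchiOn (S : Set) (s : ℕ) : Set₁ where
  field
    δ : S → Fin s → S → Set
    I : S → Set
    F : S → Set

IsAcceptingRun : ∀ {S s} → BuchiOn S s → Word s → (ℕ → S) → Set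
IsAcceptingRun B w q = I (q 0) × (∀ i → δ (q i) (w i) (q (suc i))) × InfinitelyOften (F ∘ q)
  where open BuchiOn B

AcceptsOn : ∀ {S s} → BuchiOn S s → Word s → Set
AcceptsOn {S} B w = Σ (ℕ → S) (IsAcceptingRun B w)

pullback : ∀ {S S′ s} → (S′ → S) → BuchiOn S s → BuchiOn S′ s
pullback ι B = record { δ = λ x a y → δ (ι x) a (ι y) ; I = I ∘ ι ; F = F ∘ ι }
  where open BuchiOn B

acceptingRun-pullback : ∀ {S S′ s} (B : BuchiOn S s) (ι : S′ → S) {w q} (q′ : ℕ → S′)
  → (∀ i → q i ≡ ι (q′ i)) → IsAcceptingRun B w q → IsAcceptingRun (pullback ι B) w q′
acceptingRun-pullback B ι {w} q′ q≡ (q₀∈I , steps , fair) =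
  subst I (q≡ 0) q₀∈I ,
  (λ i → subst₂ (λ x y → δ x (w i) y) (q≡ i) (q≡ (suc i)) (steps i)) ,
  λ m → let j , m≤j , Fj = fair m in j , m≤j , subst F (q≡ j) Fj
  where open BuchiOn B

onStates : ∀ {s} (B : Buchi s) → BuchiOn (Fin (Buchi.n B)) s
onStates B = record { δ = δ ; I = I ; F = F }
  where open Buchi B

module _ {S s n} (enum : Fin n ↔ S) (B : BuchiOn S s) where
  open Inverse enum
  open BuchiOn B

  enumerate : Buchi s
  enumerate = record { n = n ; δ = λ i a j → δ (to i) a (to j) ; I = I ∘ to ; F = F ∘ to }

  accepts-enumerate : ∀ {w} → AcceptsOn B w → Accepts enumerate w
  accepts-enumerate (q , run) =
    from ∘ q , acceptingRun-pullback B to (from ∘ q) (sym ∘ strictlyInverseˡ ∘ q) run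

  enumerate-accepts : ∀ {w} → Accepts enumerate w → AcceptsOn B w
  enumerate-accepts (q , q₀∈I , steps , fair) = to ∘ q , q₀∈I , steps , fair

  recognisesOn⇒ωRegular : ∀ {ℓ} {P : Word s → Set ℓ}
    → (∀ w → P w → AcceptsOn B w) → (∀ w → AcceptsOn B w → P w) → OmegaRegular P
  recognisesOn⇒ωRegular P⇒accepts accepts⇒P =
    enumerate , λ w → accepts-enumerate ∘ P⇒accepts w , accepts⇒P w ∘ enumerate-accepts

module _ {A B : Set} (R : ℕ → A ⊎ B → A ⊎ B → Set) (q : ℕ → A ⊎ B)
         (steps : ∀ i → R i (q i) (q (suc i))) where

  confinedˡ : (∀ {i a b} → ¬ R i (inj₁ a) (inj₂ b)) → ∀ {a₀} → q 0 ≡ inj₁ a₀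
            → ∀ i → q i ≡ inj₁ (fromInj₁ (λ _ → a₀) (q i))
  confinedˡ noExit q₀ zero rewrite q₀ = refl
  confinedˡ noExit q₀ (suc i) with q (suc i) | steps i
  ... | inj₁ _ | _    = refl
  ... | inj₂ _ | step = ⊥-elim (noExit (subst (λ x → R i x _) (confinedˡ noExit q₀ i) step))

  confinedʳ : (∀ {i a b} → ¬ R i (inj₂ b) (inj₁ a)) → ∀ {b₀} → q 0 ≡ inj₂ b₀
            → ∀ i → q i ≡ inj₂ (fromInj₂ (λ _ → b₀) (q i))
  confinedʳ noExit q₀ zero rewrite q₀ = refl
  confinedʳ noExit q₀ (suc i) with q (suc i) | steps i
  ... | inj₂ _ | _    = refl
  ... | inj₁ _ | step = ⊥-elim (noExit (subst (λ x → R i x _) (confinedʳ noExit q₀ i) step))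

module _ {S₁ S₂ s} (B₁ : BuchiOn S₁ s) (B₂ : BuchiOn S₂ s) where
  open BuchiOn B₁ renaming (δ to δ₁; I to I₁; F to F₁)
  open BuchiOn B₂ renaming (δ to δ₂; I to I₂; F to F₂)

  disjointUnion : BuchiOn (S₁ ⊎ S₂) s
  disjointUnion = record { δ = δ ; I = [ I₁ , I₂ ] ; F = [ F₁ , F₂ ] }
    where
    δ : S₁ ⊎ S₂ → Fin s → S₁ ⊎ S₂ → Set
    δ (inj₁ p) a (inj₁ p′) = δ₁ p a p′
    δ (inj₂ p) a (inj₂ p′) = δ₂ p a p′
    δ _        _ _         = ⊥

  open BuchiOn disjointUnion

  accepts-disjointUnion : ∀ {w} → AcceptsOn B₁ w ⊎ AcceptsOn B₂ w → AcceptsOn disjointUnion w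
  accepts-disjointUnion (inj₁ (q , q₀∈I , steps , fair)) = inj₁ ∘ q , q₀∈I , steps , fair
  accepts-disjointUnion (inj₂ (q , q₀∈I , steps , fair)) = inj₂ ∘ q , q₀∈I , steps , fair

  disjointUnion-accepts : ∀ {w} → AcceptsOn disjointUnion w → AcceptsOn B₁ w ⊎ AcceptsOn B₂ w
  disjointUnion-accepts {w} (q , run@(_ , steps , _)) = component (q 0) refl
    where
    component : ∀ x → q 0 ≡ x → AcceptsOn B₁ w ⊎ AcceptsOn B₂ w
    component (inj₁ _) q₀≡ =
      inj₁ (_ , acceptingRun-pullback disjointUnion inj₁ _
                  (confinedˡ (λ i x y → δ x (w i) y) q steps (λ ()) q₀≡) run)
    component (inj₂ _) q₀≡ =
      inj₂ (_ , acceptingRun-pullback disjointUnion inj₂ _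
                  (confinedʳ (λ i x y → δ x (w i) y) q steps (λ ()) q₀≡) run)

risingEdge : (b : ℕ → Bool) {t t′ : ℕ} → b t ≡ false → t ≤′ t′ → b t′ ≡ true
           → ∃ λ u → t ≤ℕ u × b u ≡ false × b (suc u) ≡ true
risingEdge b bt≡f ≤′-refl bt≡t with () ← trans (sym bt≡f) bt≡t
risingEdge b bt≡f (≤′-step {n = t″} t≤′t″) bt≡t with b t″ in bt″
... | true  = risingEdge b bt≡f t≤′t″ bt″
... | false = t″ , ≤′⇒≤ t≤′t″ , bt″ , bt≡t

module _ {S₁ S₂ s} (B₁ : BuchiOn S₁ s) (B₂ : BuchiOn S₂ s) where
  open BuchiOn B₁ renaming (δ to δ₁; I to I₁; F to F₁)
  open BuchiOn B₂ renaming (δ to δ₂; I to I₂; F to F₂)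

  -- The flag may only rise at an F₁-state and must drop after an accepting
  -- state of the product (raised flag at an F₂-state), so between two accepting
  -- states of the product there is an F₁-state.
  FlagStep : Bool → S₁ → S₂ → Bool → Set
  FlagStep false p _ true  = F₁ p
  FlagStep true  _ q true  = ¬ F₂ q
  FlagStep _     _ _ false = ⊤

  product : BuchiOn (S₁ × S₂ × Bool) s
  product = record
    { δ = λ { (p , q , b) a (p′ , q′ , b′) → δ₁ p a p′ × δ₂ q a q′ × FlagStep b p q b′ }
    ; I = λ { (p , q , b) → I₁ p × I₂ q × b ≡ false }
    ; F = λ { (p , q , b) → b ≡ true × F₂ q }
    }

  product-accepts : ∀ {w} → AcceptsOn product w → AcceptsOn B₁ w × AcceptsOn B₂ w
  product-accepts {w} (r , (p₀∈I , q₀∈I , _) , steps , fair) =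
    (p , p₀∈I , proj₁ ∘ steps , fair₁) ,
    (q , q₀∈I , proj₁ ∘ proj₂ ∘ steps , λ m → let j , m≤j , _ , F₂q = fair m in j , m≤j , F₂q)
    where
    p = proj₁ ∘ r
    q = proj₁ ∘ proj₂ ∘ r
    b = proj₂ ∘ proj₂ ∘ r
    flagStep : ∀ i → FlagStep (b i) (p i) (q i) (b (suc i))
    flagStep = proj₂ ∘ proj₂ ∘ steps
    drops : ∀ j → b j ≡ true → F₂ (q j) → b (suc j) ≡ false
    drops j bj≡t F₂q with b (suc j) | flagStep j
    ... | false | _    = refl
    ... | true  | step = ⊥-elim (subst (λ x → FlagStep x (p j) (q j) true) bj≡t step F₂q)
    F₁-at-rise : ∀ u → b u ≡ false → b (suc u) ≡ true → F₁ (p u)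
    F₁-at-rise u bu≡f bu+1≡t =
      subst₂ (λ x y → FlagStep x (p u) (q u) y) bu≡f bu+1≡t (flagStep u)
    fair₁ : InfinitelyOften (F₁ ∘ p)
    fair₁ m =
      let j , m≤j , bj≡t , F₂q = fair m
          j′ , j<j′ , bj′≡t , _ = fair (suc j)
          u , j<u , bu≡f , bu+1≡t = risingEdge b (drops j bj≡t F₂q) (≤⇒≤′ j<j′) bj′≡t
      in u , ≤-trans m≤j (≤-trans (n≤1+n j) j<u) , F₁-at-rise u bu≡f bu+1≡t

  module _ (em : ∀ {ℓ} → ExcludedMiddle ℓ) where

    nextFlag : Bool → S₁ → S₂ → Bool
    nextFlag false p _ = isYes (em {P = F₁ p})
    nextFlag true  _ q = isNo (em {P = F₂ q})

    flagStep-nextFlag : ∀ b p q → FlagStep b p q (nextFlag b p q)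
    flagStep-nextFlag false p q with em {P = F₁ p}
    ... | yes F₁p = F₁p
    ... | no  _   = tt
    flagStep-nextFlag true p q with em {P = F₂ q}
    ... | yes _    = tt
    ... | no ¬F₂q = ¬F₂q

    nextFlag-F₁ : ∀ {p} q → F₁ p → nextFlag false p q ≡ true
    nextFlag-F₁ {p} q F₁p with em {P = F₁ p}
    ... | yes _    = refl
    ... | no ¬F₁p = ⊥-elim (¬F₁p F₁p)

    nextFlag-¬F₂ : ∀ p {q} → ¬ F₂ q → nextFlag true p q ≡ true
    nextFlag-¬F₂ p {q} ¬F₂q with em {P = F₂ q}
    ... | yes F₂q = ⊥-elim (¬F₂q F₂q)
    ... | no _    = refl

    accepts-product : ∀ {w} → AcceptsOn B₁ w → AcceptsOn B₂ w → AcceptsOn product w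
    accepts-product {w} (p , p₀∈I , steps₁ , fair₁) (q , q₀∈I , steps₂ , fair₂) =
      (λ i → p i , q i , b i) , (p₀∈I , q₀∈I , refl) ,
      (λ i → steps₁ i , steps₂ i , flagStep-nextFlag (b i) (p i) (q i)) , fair
      where
      b : ℕ → Bool
      b zero    = false
      b (suc i) = nextFlag (b i) (p i) (q i)
      raised : ∀ v → F₁ (p v) → ∃ λ u → v ≤ℕ u × b u ≡ true
      raised v F₁p with b v in bv
      ... | true  = v , ≤-refl , bv
      ... | false = suc v , n≤1+n v ,
                    trans (cong (λ x → nextFlag x (p v) (q v)) bv) (nextFlag-F₁ (q v) F₁p)
      stays : ∀ {t t′} → b t ≡ true → t ≤′ t′
            → (∃ λ j → t ≤ℕ j × b j ≡ true × F₂ (q j)) ⊎ b t′ ≡ true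
      stays bt≡t ≤′-refl = inj₂ bt≡t
      stays bt≡t (≤′-step {n = t″} t≤′t″) with stays bt≡t t≤′t″
      ... | inj₁ found = inj₁ found
      ... | inj₂ bt″≡t with em {P = F₂ (q t″)}
      ...   | yes F₂q  = inj₁ (t″ , ≤′⇒≤ t≤′t″ , bt″≡t , F₂q)
      ...   | no ¬F₂q =
        inj₂ (trans (cong (λ x → nextFlag x (p t″) (q t″)) bt″≡t) (nextFlag-¬F₂ (p t″) ¬F₂q))
      fair : InfinitelyOften (λ j → b j ≡ true × F₂ (q j))
      fair m with fair₁ m
      ... | v , m≤v , F₁p with raised v F₁p
      ... | u , v≤u , bu≡t with fair₂ u
      ... | t , u≤t , F₂q with stays bu≡t (≤⇒≤′ u≤t)
      ... | inj₁ (j , u≤j , found) = j , ≤-trans m≤v (≤-trans v≤u u≤j) , found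
      ... | inj₂ bt≡t = t , ≤-trans m≤v (≤-trans v≤u u≤t) , bt≡t , F₂q

-- Closure properties of ω-regular languages

module _ {s : ℕ} where

  ωRegular-cong : ∀ {ℓ ℓ′} {P : Word s → Set ℓ} {Q : Word s → Set ℓ′}
    → (∀ w → P w → Q w) → (∀ w → Q w → P w) → OmegaRegular P → OmegaRegular Q
  ωRegular-cong P⇒Q Q⇒P (B , rec) = B , λ w → proj₁ (rec w) ∘ Q⇒P w , P⇒Q w ∘ proj₂ (rec w)

  ∅-ωRegular : OmegaRegular {s = s} (λ _ → ⊥)
  ∅-ωRegular = record { n = 0 ; δ = λ _ _ _ → ⊤ ; I = λ _ → ⊤ ; F = λ _ → ⊤ } ,
    λ w → ⊥-elim , λ (q , _) → case q 0 of λ ()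

  full-ωRegular : OmegaRegular {s = s} (λ _ → ⊤)
  full-ωRegular = record { n = 1 ; δ = λ _ _ _ → ⊤ ; I = λ _ → ⊤ ; F = λ _ → ⊤ } ,
    λ w → (λ _ → (λ _ → fzero) , tt , (λ _ → tt) , λ m → m , ≤-refl , tt) , λ _ → tt

  ∪-ωRegular : ∀ {ℓ ℓ′} {P : Word s → Set ℓ} {Q : Word s → Set ℓ′}
    → OmegaRegular P → OmegaRegular Q → OmegaRegular (λ w → P w ⊎ Q w)
  ∪-ωRegular (B₁ , rec₁) (B₂ , rec₂) =
    recognisesOn⇒ωRegular +↔⊎ (disjointUnion (onStates B₁) (onStates B₂))
      (λ w → accepts-disjointUnion _ _ ∘ Sum.map (proj₁ (rec₁ w)) (proj₁ (rec₂ w)))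
      (λ w → Sum.map (proj₂ (rec₁ w)) (proj₂ (rec₂ w)) ∘ disjointUnion-accepts _ _)

  ∩-ωRegular : (em : ∀ {ℓ} → ExcludedMiddle ℓ)
    → ∀ {ℓ ℓ′} {P : Word s → Set ℓ} {Q : Word s → Set ℓ′}
    → OmegaRegular P → OmegaRegular Q → OmegaRegular (λ w → P w × Q w)
  ∩-ωRegular em (B₁ , rec₁) (B₂ , rec₂) =
    recognisesOn⇒ωRegular enum (product (onStates B₁) (onStates B₂))
      (λ w (Pw , Qw) → accepts-product _ _ em (proj₁ (rec₁ w) Pw) (proj₁ (rec₂ w) Qw))
      (λ w → Product.map (proj₂ (rec₁ w)) (proj₂ (rec₂ w)) ∘ product-accepts _ _)
    where
    enum = (↔-id _ ×-↔ ((↔-id _ ×-↔ 2↔Bool) ↔-∘ *↔×)) ↔-∘ *↔×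

  Any-ωRegular : ∀ {ℓ} {X : Set} {P : X → Word s → Set ℓ} (xs : List X)
    → (∀ x → OmegaRegular (P x)) → OmegaRegular (λ w → Any (λ x → P x w) xs)
  Any-ωRegular []       _   = ωRegular-cong (λ _ ()) (λ _ ()) ∅-ωRegular
  Any-ωRegular (x ∷ xs) reg =
    ωRegular-cong (λ _ → Any.fromSum) (λ _ → Any.toSum) (∪-ωRegular (reg x) (Any-ωRegular xs reg))

  Π-ωRegular : (em : ∀ {ℓ} → ExcludedMiddle ℓ) → ∀ {ℓ k} {P : Fin k → Word s → Set ℓ}
    → (∀ i → OmegaRegular (P i)) → OmegaRegular (λ w → ∀ i → P i w)
  Π-ωRegular em {k = zero}  _   = ωRegular-cong (λ _ _ ()) (λ _ _ → tt) full-ωRegular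
  Π-ωRegular em {k = suc k} reg =
    ωRegular-cong (λ _ → uncurry ∀-cons) (λ _ Pw → Pw fzero , Pw ∘ fsuc)
      (∩-ωRegular em (reg fzero) (Π-ωRegular em (reg ∘ fsuc)))

  guard×-ωRegular : ∀ {q ℓ} {Q : Set q} {P : Word s → Set ℓ}
    → Dec Q → OmegaRegular P → OmegaRegular (λ w → Q × P w)
  guard×-ωRegular (yes Q) reg = ωRegular-cong (λ _ → Q ,_) (λ _ → proj₂) reg
  guard×-ωRegular (no ¬Q) _   = ωRegular-cong (λ _ ()) (λ _ → ¬Q ∘ proj₁) ∅-ωRegular

  guard→-ωRegular : ∀ {q ℓ} {Q : Set q} {P : Word s → Set ℓ}
    → Dec Q → OmegaRegular P → OmegaRegular (λ w → Q → P w)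
  guard→-ωRegular (yes Q) reg = ωRegular-cong (λ _ Pw _ → Pw) (λ _ Q⇒Pw → Q⇒Pw Q) reg
  guard→-ωRegular (no ¬Q) _   = ωRegular-cong (λ _ _ Q → ⊥-elim (¬Q Q)) (λ _ _ → tt) full-ωRegular

subsets : ∀ k → List (Subset k)
subsets zero    = [] ∷ []
subsets (suc k) = cartesianProductWith _∷_ (true ∷ false ∷ []) (subsets k)

∈-subsets : ∀ {k} (p : Subset k) → p ∈ subsets k
∈-subsets []      = here refl
∈-subsets (b ∷ p) = ∈-cartesianProductWith⁺ _∷_ (bool∈ b) (∈-subsets p)
  where
  bool∈ : ∀ b → b ∈ true ∷ false ∷ []
  bool∈ true  = here refl
  bool∈ false = there (here refl)

-- l-valued Büchi automata

module _ {c ℓ₁ ℓ₂} (L : CompleteDistributiveLattice c ℓ₁ ℓ₂) where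
  open CompleteDistributiveLattice L
    using ( Carrier; _≈_; _≤_; _∧_; ⋁; ⋁-upper; ⋁-least; ⋀; ⋀-lower; ⋀-great
          ; antisym; reflexive; x∧y≤x; x∧y≤y; ∧-greatest; module Eq)
    renaming (refl to ≤ᴸ-refl; trans to ≤ᴸ-trans)

  ≡⇒≤ᴸ : ∀ {x y} → x ≡ y → x ≤ y
  ≡⇒≤ᴸ = reflexive ∘ Eq.reflexive

  ⊥ᴸ : Carrier
  ⊥ᴸ = ⋁ {I = Lift c ⊥} λ ()

  ⊥ᴸ-least : ∀ x → ⊥ᴸ ≤ x
  ⊥ᴸ-least x = ⋁-least _ x λ ()

  ⋁-mono : ∀ {I J : Set c} (g : I → Carrier) (h : J → Carrier)
    → (∀ i → ∃ λ j → g i ≤ h j) → ⋁ g ≤ ⋁ h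
  ⋁-mono g h dominated =
    ⋁-least g (⋁ h) λ i → let j , gi≤hj = dominated i in ≤ᴸ-trans gi≤hj (⋁-upper h j)

  ⋁[_]_ : ∀ {k} → (Fin k → Set) → (Fin k → Carrier) → Carrier
  ⋁[_]_ {k} P m = ⋁ {I = Lift c (Σ (Fin k) P)} (m ∘ proj₁ ∘ lower)

  ⋀[_]_ : ∀ {k} → (Fin k → Set) → (Fin k → Carrier) → Carrier
  ⋀[_]_ {k} P m = ⋀ {I = Lift c (Σ (Fin k) P)} (m ∘ proj₁ ∘ lower)

  ⋁[]-mono : ∀ {k} {P Q : Fin k → Set} (m : Fin k → Carrier)
    → (∀ i → P i → Q i) → ⋁[ P ] m ≤ ⋁[ Q ] m
  ⋁[]-mono m P⊆Q = ⋁-mono _ _ λ { (lift (i , Pi)) → lift (i , P⊆Q i Pi) , ≤ᴸ-refl }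

  ⋁[]-cong : ∀ {k} {P Q : Fin k → Set} (m : Fin k → Carrier)
    → (∀ i → P i → Q i) → (∀ i → Q i → P i) → ⋁[ P ] m ≈ ⋁[ Q ] m
  ⋁[]-cong m P⊆Q Q⊆P = antisym (⋁[]-mono m P⊆Q) (⋁[]-mono m Q⊆P)

  module _ {s} (A : LBuchi L s) where
    open LBuchi A

    Run : Set
    Run = Σ (ℕ → Fin n) λ q → Σ (ℕ → Bool) InfiniteSet

    states : Run → ℕ → Fin n
    states = proj₁

    marked : Run → ℕ → Bool
    marked = proj₁ ∘ proj₂

    runValue : Word s → Run → Carrier
    runValue w (q , J , _) =
      I (q 0) ∧ (⋀ {I = Lift c ℕ} (λ i → δ (q (lower i)) (w (lower i)) (q (suc (lower i))))
              ∧ ⋀ {I = Lift c (Σ ℕ λ j → T (J j))} (F ∘ q ∘ proj₁ ∘ lower))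

    runValue≤Lω : ∀ w r → runValue w r ≤ Lω L A w
    runValue≤Lω w r = ⋁-upper _ (lift r)

    Lω-least : ∀ w y → (∀ r → runValue w r ≤ y) → Lω L A w ≤ y
    Lω-least w y bounded = ⋁-least _ y (bounded ∘ lower)

    runValue≤I : ∀ {w} r → runValue w r ≤ I (states r 0)
    runValue≤I r = x∧y≤x _ _

    runValue≤δ : ∀ {w} r i → runValue w r ≤ δ (states r i) (w i) (states r (suc i))
    runValue≤δ r i = ≤ᴸ-trans (x∧y≤y _ _) (≤ᴸ-trans (x∧y≤x _ _) (⋀-lower _ (lift i)))

    runValue≤F : ∀ {w} r j → T (marked r j) → runValue w r ≤ F (states r j)
    runValue≤F r j j∈J = ≤ᴸ-trans (x∧y≤y _ _) (≤ᴸ-trans (x∧y≤y _ _) (⋀-lower _ (lift (j , j∈J))))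

    ≤runValue : ∀ {w} r {z} → z ≤ I (states r 0)
              → (∀ i → z ≤ δ (states r i) (w i) (states r (suc i)))
              → (∀ j → T (marked r j) → z ≤ F (states r j))
              → z ≤ runValue w r
    ≤runValue r z≤I z≤δ z≤F =
      ∧-greatest z≤I (∧-greatest (⋀-great _ _ (z≤δ ∘ lower))
                                 (⋀-great _ _ λ { (lift (j , j∈J)) → z≤F j j∈J }))

  runValue-mono : ∀ {s} (A A′ : LBuchi L s) {w}
    (q : ℕ → Fin (LBuchi.n A)) (q′ : ℕ → Fin (LBuchi.n A′)) {J} (J-inf : InfiniteSet J)
    → LBuchi.I A (q 0) ≤ LBuchi.I A′ (q′ 0)
    → (∀ i → LBuchi.δ A (q i) (w i) (q (suc i)) ≤ LBuchi.δ A′ (q′ i) (w i) (q′ (suc i)))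
    → (∀ j → LBuchi.F A (q j) ≤ LBuchi.F A′ (q′ j))
    → runValue A w (q , J , J-inf) ≤ runValue A′ w (q′ , J , J-inf)
  runValue-mono A A′ q q′ J-inf I≤ δ≤ F≤ =
    ≤runValue A′ (q′ , _ , J-inf)
      (≤ᴸ-trans (runValue≤I A r) I≤)
      (λ i → ≤ᴸ-trans (runValue≤δ A r i) (δ≤ i))
      (λ j j∈J → ≤ᴸ-trans (runValue≤F A r j j∈J) (F≤ j))
    where
    r = q , _ , J-inf

  Lω-simulation : ∀ {s} (A A′ : LBuchi L s) (ι : Fin (LBuchi.n A) → Fin (LBuchi.n A′))
    → (∀ p → LBuchi.I A p ≤ LBuchi.I A′ (ι p))
    → (∀ p a p′ → LBuchi.δ A p a p′ ≤ LBuchi.δ A′ (ι p) a (ι p′))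
    → (∀ p → LBuchi.F A p ≤ LBuchi.F A′ (ι p))
    → ∀ w → Lω L A w ≤ Lω L A′ w
  Lω-simulation A A′ ι I≤ δ≤ F≤ w = Lω-least A w _ λ (q , J , J-inf) →
    ≤ᴸ-trans (runValue-mono A A′ q (ι ∘ q) J-inf
               (I≤ (q 0)) (λ i → δ≤ (q i) (w i) (q (suc i))) (F≤ ∘ q))
             (runValue≤Lω A′ w (ι ∘ q , J , J-inf))

  when : ∀ {ℓ} {P : Set ℓ} → Dec P → Carrier → Carrier
  when (yes _) m = m
  when (no _)  _ = ⊥ᴸ

  when-yes : ∀ {ℓ} {P : Set ℓ} (d : Dec P) {m} → P → m ≤ when d m
  when-yes (yes _) _ = ≤ᴸ-refl
  when-yes (no ¬P) P = ⊥-elim (¬P P)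

  when-no : ∀ {ℓ} {P : Set ℓ} (d : Dec P) {m} → ¬ P → when d m ≤ ⊥ᴸ
  when-no (yes P) ¬P = ⊥-elim (¬P P)
  when-no (no _)  _  = ≤ᴸ-refl

  when≤ : ∀ {ℓ} {P : Set ℓ} (d : Dec P) {m} → when d m ≤ m
  when≤ (yes _) = ≤ᴸ-refl
  when≤ (no _)  = ⊥ᴸ-least _

  module _ (em : ∀ {ℓ} → ExcludedMiddle ℓ) where

    subsetOf : ∀ {ℓ k} → (Fin k → Set ℓ) → Subset k
    subsetOf P = tabulate λ i → does (em {P = P i})

    ∈-subsetOf⁺ : ∀ {ℓ k} {P : Fin k → Set ℓ} {i} → P i → i ∈ₛ subsetOf P
    ∈-subsetOf⁺ {i = i} Pi = lookup⇒[]= i _ (trans (lookup∘tabulate _ i) (dec-true em Pi))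

    ∈-subsetOf⁻ : ∀ {ℓ k} {P : Fin k → Set ℓ} {i} → i ∈ₛ subsetOf P → P i
    ∈-subsetOf⁻ {P = P} {i} i∈ with em {P = P i} | trans (sym (lookup∘tabulate _ i)) ([]=⇒lookup i∈)
    ... | yes Pi | _ = Pi
    ... | no _   | ()

    -- (1) ⇒ (3)

    ⋀ₛ : (W : List Carrier) → Subset (List.length W) → Carrier
    ⋀ₛ W p = ⋀[ _∈ₛ p ] List.lookup W

    meets : List Carrier → List Carrier
    meets W = List.map (⋀ₛ W) (subsets (List.length W))

    above : (W : List Carrier) → Carrier → Subset (List.length W)
    above W x = subsetOf λ i → x ≤ List.lookup W i

    ≤⋀ₛ-above : ∀ W x → x ≤ ⋀ₛ W (above W x)
    ≤⋀ₛ-above W x = ⋀-great _ x λ { (lift (i , i∈)) → ∈-subsetOf⁻ i∈ }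

    ⋀ₛ-above≤ : ∀ W {x y} → x ≤ y → y ∈ W → ⋀ₛ W (above W x) ≤ y
    ⋀ₛ-above≤ W x≤y y∈W =
      ≤ᴸ-trans (⋀-lower _ (lift (i , ∈-subsetOf⁺ (subst (_ ≤_) y≡Wᵢ x≤y)))) (≡⇒≤ᴸ (sym y≡Wᵢ))
      where
      i = Any.index y∈W
      y≡Wᵢ = lookup-index y∈W

    module _ {s} (A : LBuchi L s) where
      open LBuchi A

      threshold : Carrier → Buchi s
      threshold a = record
        { n = n
        ; δ = λ p x p′ → True (em {P = a ≤ δ p x p′})
        ; I = λ p → True (em {P = a ≤ I p})
        ; F = λ p → True (em {P = a ≤ F p})
        }

      accepts-threshold : ∀ {a w} r → a ≤ runValue A w r → Accepts (threshold a) w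
      accepts-threshold r@(q , J , J-inf) a≤ =
        q , fromWitness (≤ᴸ-trans a≤ (runValue≤I A r)) ,
        (λ i → fromWitness (≤ᴸ-trans a≤ (runValue≤δ A r i))) ,
        λ m → let j , m≤j , j∈J = J-inf m
              in j , m≤j , fromWitness (≤ᴸ-trans a≤ (runValue≤F A r j j∈J))

      threshold-accepts : ∀ {a w} → Accepts (threshold a) w → ∃ λ r → a ≤ runValue A w r
      threshold-accepts {a} (q , q₀ , steps , fair) =
        r , ≤runValue A r (toWitness q₀) (toWitness ∘ steps) (λ _ → toWitness)
        where
        r = q , (λ j → isYes (em {P = a ≤ F (q j)})) , fair

      Lω≈⋁threshold : (M : List Carrier) → (∀ w r → Any (runValue A w r ≈_) M)
        → ∀ w → Lω L A w ≈ ⋁[ (λ i → Accepts (threshold (List.lookup M i)) w) ] List.lookup M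
      Lω≈⋁threshold M covered w = antisym
        (Lω-least A w _ λ r →
          let v≈Mᵢ = lookup-index (covered w r)
          in ≤ᴸ-trans (reflexive v≈Mᵢ)
               (⋁-upper _ (lift (Any.index (covered w r) , accepts-threshold r (reflexive (Eq.sym v≈Mᵢ))))))
        (⋁-least _ _ λ { (lift (i , acc)) →
          let r , Mᵢ≤v = threshold-accepts acc in ≤ᴸ-trans Mᵢ≤v (runValue≤Lω A w r) })

      weights : List Carrier
      weights = List.map I (allFin n) ++ List.map F (allFin n) ++ δ-weights
        where
        δ-weights = cartesianProductWith (λ p → uncurry (δ p)) (allFin n)
                                         (cartesianProduct (allFin s) (allFin n))

      I∈weights : ∀ p → I p ∈ weights
      I∈weights p = ∈-++⁺ˡ (∈-map⁺ I (∈-allFin p))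

      F∈weights : ∀ p → F p ∈ weights
      F∈weights p = ∈-++⁺ʳ (List.map I (allFin n)) (∈-++⁺ˡ (∈-map⁺ F (∈-allFin p)))

      δ∈weights : ∀ p x p′ → δ p x p′ ∈ weights
      δ∈weights p x p′ =
        ∈-++⁺ʳ (List.map I (allFin n)) (∈-++⁺ʳ (List.map F (allFin n))
          (∈-cartesianProductWith⁺ (λ p → uncurry (δ p))
            (∈-allFin p) (∈-cartesianProduct⁺ (∈-allFin x) (∈-allFin p′))))

      runValue∈meets : ∀ w r → Any (runValue A w r ≈_) (meets weights)
      runValue∈meets w r@(q , J , _) = lose (∈-map⁺ (⋀ₛ weights) (∈-subsets (above weights v)))
        (antisym (≤⋀ₛ-above weights v)
                 (≤runValue A r
                   (⋀ₛ-above≤ weights (runValue≤I A r) (I∈weights (q 0)))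
                   (λ i → ⋀ₛ-above≤ weights (runValue≤δ A r i) (δ∈weights (q i) (w i) (q (suc i))))
                   (λ j j∈J → ⋀ₛ-above≤ weights (runValue≤F A r j j∈J) (F∈weights (q j)))))
        where
        v = runValue A w r

    -- (3) ⇒ (2)

    module _ {s k} (m : Fin k → Carrier) (Ls : Fin k → Word s → Set) where

      joins : List Carrier
      joins = List.map (λ p → ⋁[ _∈ₛ p ] m) (subsets k)

      ⋁[]∈joins : ∀ w → Any (⋁[ (λ i → Ls i w) ] m ≈_) joins
      ⋁[]∈joins w = lose (∈-map⁺ _ (∈-subsets (subsetOf λ i → Ls i w)))
                         (⋁[]-cong m (λ _ → ∈-subsetOf⁺) (λ _ → ∈-subsetOf⁻))

      ≤⋁[]⇔ : ∀ {a} w → a ≤ ⋁[ (λ i → Ls i w) ] m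
        ⇔ Any (λ p → a ≤ ⋁[ _∈ₛ p ] m × (∀ i → i ∈ₛ p → Ls i w)) (subsets k)
      ≤⋁[]⇔ w = mk⇔
        (λ a≤ → lose (∈-subsets (subsetOf λ i → Ls i w))
                     (≤ᴸ-trans a≤ (⋁[]-mono m (λ _ → ∈-subsetOf⁺)) , λ _ → ∈-subsetOf⁻))
        (λ found → let _ , a≤ , p⊆ = Any.satisfied found in ≤ᴸ-trans a≤ (⋁[]-mono m p⊆))

    -- (3) ⇒ (1)

    _∧ᴬ_ : ∀ {s} → Carrier → Buchi s → LBuchi L s
    m ∧ᴬ B = record
      { n = n
      ; δ = λ p x p′ → when (em {P = δ p x p′}) m
      ; I = λ p → when (em {P = I p}) m
      ; F = λ p → when (em {P = F p}) m
      }
      where open Buchi B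

    module _ {s} (m : Carrier) (B : Buchi s) where
      open Buchi B

      accepting-or-⊥ : ∀ w r → Accepts B w ⊎ runValue (m ∧ᴬ B) w r ≤ ⊥ᴸ
      accepting-or-⊥ w r@(q , J , J-inf) = decide (em {P = I (q 0)}) (em {P = BadStep}) (em {P = BadMark})
        where
        BadStep = ∃ λ i → ¬ δ (q i) (w i) (q (suc i))
        BadMark = ∃ λ j → T (J j) × ¬ F (q j)
        decide : Dec (I (q 0)) → Dec BadStep → Dec BadMark
               → Accepts B w ⊎ runValue (m ∧ᴬ B) w r ≤ ⊥ᴸ
        decide (no ¬I₀) _ _ =
          inj₂ (≤ᴸ-trans (runValue≤I (m ∧ᴬ B) r) (when-no (em {P = I (q 0)}) ¬I₀))
        decide _ (yes (i , ¬δᵢ)) _ =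
          inj₂ (≤ᴸ-trans (runValue≤δ (m ∧ᴬ B) r i)
                         (when-no (em {P = δ (q i) (w i) (q (suc i))}) ¬δᵢ))
        decide _ _ (yes (j , j∈J , ¬Fⱼ)) =
          inj₂ (≤ᴸ-trans (runValue≤F (m ∧ᴬ B) r j j∈J) (when-no (em {P = F (q j)}) ¬Fⱼ))
        decide (yes I₀) (no noBadStep) (no noBadMark) =
          inj₁ (q , I₀ , (λ i → decidable-stable em λ ¬δᵢ → noBadStep (i , ¬δᵢ)) ,
                λ m → let j , m≤j , j∈J = J-inf m
                      in j , m≤j , decidable-stable em λ ¬Fⱼ → noBadMark (j , j∈J , ¬Fⱼ))

      Lω-∧ᴬ-least : ∀ w y → (Accepts B w → m ≤ y) → Lω L (m ∧ᴬ B) w ≤ y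
      Lω-∧ᴬ-least w y m≤y = Lω-least (m ∧ᴬ B) w y λ r → case accepting-or-⊥ w r of λ where
        (inj₁ acc) →
          ≤ᴸ-trans (runValue≤I (m ∧ᴬ B) r)
                   (≤ᴸ-trans (when≤ (em {P = I (states (m ∧ᴬ B) r 0)})) (m≤y acc))
        (inj₂ ≤⊥)  → ≤ᴸ-trans ≤⊥ (⊥ᴸ-least y)

      ≤Lω-∧ᴬ : ∀ w → Accepts B w → m ≤ Lω L (m ∧ᴬ B) w
      ≤Lω-∧ᴬ w (q , I₀ , steps , fair) = ≤ᴸ-trans
        (≤runValue (m ∧ᴬ B) r
          (when-yes (em {P = I (q 0)}) I₀)
          (λ i → when-yes (em {P = δ (q i) (w i) (q (suc i))}) (steps i))
          (λ j j∈J → when-yes (em {P = F (q j)}) (toWitness j∈J)))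
        (runValue≤Lω (m ∧ᴬ B) w r)
        where
        r = q , (λ j → isYes (em {P = F (q j)})) ,
            λ m → let j , m≤j , Fⱼ = fair m in j , m≤j , fromWitness Fⱼ

    module DisjointSum {s} (A₁ A₂ : LBuchi L s) where
      open LBuchi A₁ renaming (n to n₁; δ to δ₁; I to I₁; F to F₁)
      open LBuchi A₂ renaming (n to n₂; δ to δ₂; I to I₂; F to F₂)

      Switch : Fin n₁ ⊎ Fin n₂ → Fin n₁ ⊎ Fin n₂ → Set
      Switch (inj₁ _) (inj₂ _) = ⊤
      Switch (inj₂ _) (inj₁ _) = ⊤
      Switch _        _        = ⊥

      δ⊎ : Fin n₁ ⊎ Fin n₂ → Fin s → Fin n₁ ⊎ Fin n₂ → Carrier
      δ⊎ (inj₁ p) a (inj₁ p′) = δ₁ p a p′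
      δ⊎ (inj₂ p) a (inj₂ p′) = δ₂ p a p′
      δ⊎ _        _ _         = ⊥ᴸ

      δ⊎-switch : ∀ x a y → Switch x y → δ⊎ x a y ≤ ⊥ᴸ
      δ⊎-switch (inj₁ _) _ (inj₂ _) _ = ≤ᴸ-refl
      δ⊎-switch (inj₂ _) _ (inj₁ _) _ = ≤ᴸ-refl

      side : Fin (n₁ + n₂) → Fin n₁ ⊎ Fin n₂
      side = splitAt n₁

      sum : LBuchi L s
      sum = record
        { n = n₁ + n₂
        ; δ = λ i a j → δ⊎ (side i) a (side j)
        ; I = [ I₁ , I₂ ] ∘ side
        ; F = [ F₁ , F₂ ] ∘ side
        }

      Lω₁≤Lω-sum : ∀ w → Lω L A₁ w ≤ Lω L sum w
      Lω₁≤Lω-sum = Lω-simulation A₁ sum (_↑ˡ n₂)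
        (λ p → ≡⇒≤ᴸ (cong [ I₁ , I₂ ] (side-↑ˡ p)))
        (λ p a p′ → ≡⇒≤ᴸ (cong₂ (λ x y → δ⊎ x a y) (side-↑ˡ p) (side-↑ˡ p′)))
        (λ p → ≡⇒≤ᴸ (cong [ F₁ , F₂ ] (side-↑ˡ p)))
        where
        side-↑ˡ : ∀ p → inj₁ p ≡ side (p ↑ˡ n₂)
        side-↑ˡ p = sym (splitAt-↑ˡ n₁ p n₂)

      Lω₂≤Lω-sum : ∀ w → Lω L A₂ w ≤ Lω L sum w
      Lω₂≤Lω-sum = Lω-simulation A₂ sum (n₁ ↑ʳ_)
        (λ p → ≡⇒≤ᴸ (cong [ I₁ , I₂ ] (side-↑ʳ p)))
        (λ p a p′ → ≡⇒≤ᴸ (cong₂ (λ x y → δ⊎ x a y) (side-↑ʳ p) (side-↑ʳ p′)))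
        (λ p → ≡⇒≤ᴸ (cong [ F₁ , F₂ ] (side-↑ʳ p)))
        where
        side-↑ʳ : ∀ p → inj₂ p ≡ side (n₁ ↑ʳ p)
        side-↑ʳ p = sym (splitAt-↑ʳ n₁ n₂ p)

      Lω-sum-least : ∀ w y → Lω L A₁ w ≤ y → Lω L A₂ w ≤ y → Lω L sum w ≤ y
      Lω-sum-least w y Lω₁≤y Lω₂≤y = Lω-least sum w y λ r@(q , _) →
        case em {P = ∃ λ u → Switch (side (q u)) (side (q (suc u)))} of λ where
          (yes (u , switch)) →
            ≤ᴸ-trans (runValue≤δ sum r u) (≤ᴸ-trans (δ⊎-switch _ (w u) _ switch) (⊥ᴸ-least y))
          (no noSwitch) → confined r noSwitch (side (q 0)) refl
        where
        confined : ∀ r → ¬ (∃ λ u → Switch (side (states sum r u)) (side (states sum r (suc u))))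
                 → ∀ x → side (states sum r 0) ≡ x → runValue sum w r ≤ y
        confined (q , J , J-inf) noSwitch (inj₁ p) t₀≡ =
          ≤ᴸ-trans (runValue-mono sum A₁ q q₁ J-inf
                     (≡⇒≤ᴸ (cong [ I₁ , I₂ ] (e 0)))
                     (λ i → ≡⇒≤ᴸ (cong₂ (λ x y → δ⊎ x (w i) y) (e i) (e (suc i))))
                     (λ j → ≡⇒≤ᴸ (cong [ F₁ , F₂ ] (e j))))
                   (≤ᴸ-trans (runValue≤Lω A₁ w (q₁ , J , J-inf)) Lω₁≤y)
          where
          q₁ = fromInj₁ (λ _ → p) ∘ side ∘ q
          e = confinedˡ (λ _ x y → ¬ Switch x y) (side ∘ q) (λ u switch → noSwitch (u , switch))
                        (λ noExit → noExit tt) t₀≡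
        confined (q , J , J-inf) noSwitch (inj₂ p) t₀≡ =
          ≤ᴸ-trans (runValue-mono sum A₂ q q₂ J-inf
                     (≡⇒≤ᴸ (cong [ I₁ , I₂ ] (e 0)))
                     (λ i → ≡⇒≤ᴸ (cong₂ (λ x y → δ⊎ x (w i) y) (e i) (e (suc i))))
                     (λ j → ≡⇒≤ᴸ (cong [ F₁ , F₂ ] (e j))))
                   (≤ᴸ-trans (runValue≤Lω A₂ w (q₂ , J , J-inf)) Lω₂≤y)
          where
          q₂ = fromInj₂ (λ _ → p) ∘ side ∘ q
          e = confinedʳ (λ _ x y → ¬ Switch x y) (side ∘ q) (λ u switch → noSwitch (u , switch))
                        (λ noExit → noExit tt) t₀≡

    ∅ᴬ : ∀ {s} → LBuchi L s
    ∅ᴬ = record { n = 0 ; δ = λ () ; I = λ () ; F = λ () }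

    Lω-∅ᴬ-least : ∀ {s} w y → Lω L (∅ᴬ {s}) w ≤ y
    Lω-∅ᴬ-least w y = Lω-least ∅ᴬ w y λ (q , _) → case q 0 of λ ()

    ⋁ᴬ : ∀ {s k} → (Fin k → Carrier) → (Fin k → Buchi s) → LBuchi L s
    ⋁ᴬ {k = zero}  m B = ∅ᴬ
    ⋁ᴬ {k = suc k} m B = DisjointSum.sum (m fzero ∧ᴬ B fzero) (⋁ᴬ (m ∘ fsuc) (B ∘ fsuc))

    Lω-⋁ᴬ : ∀ {s k} (m : Fin k → Carrier) (B : Fin k → Buchi s) w
          → Lω L (⋁ᴬ m B) w ≈ ⋁[ (λ i → Accepts (B i) w) ] m
    Lω-⋁ᴬ {k = zero}  m B w = antisym (Lω-∅ᴬ-least w _) (⋁-least _ _ λ { (lift (() , _)) })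
    Lω-⋁ᴬ {k = suc k} m B w = antisym
      (Lω-sum-least w _
        (Lω-∧ᴬ-least (m fzero) (B fzero) w _ λ acc → ⋁-upper _ (lift (fzero , acc)))
        (≤ᴸ-trans (reflexive IH) (⋁-mono _ _ λ { (lift (i , acc)) → lift (fsuc i , acc) , ≤ᴸ-refl })))
      (⋁-least _ _ λ where
        (lift (fzero , acc))  → ≤ᴸ-trans (≤Lω-∧ᴬ (m fzero) (B fzero) w acc) (Lω₁≤Lω-sum w)
        (lift (fsuc i , acc)) →
          ≤ᴸ-trans (⋁-upper _ (lift (i , acc))) (≤ᴸ-trans (reflexive (Eq.sym IH)) (Lω₂≤Lω-sum w)))
      where
      open DisjointSum (m fzero ∧ᴬ B fzero) (⋁ᴬ (m ∘ fsuc) (B ∘ fsuc))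
      IH = Lω-⋁ᴬ (m ∘ fsuc) (B ∘ fsuc) w

    module _ {s} {f : Word s → Carrier} where

      Cond1⇒Cond3 : Cond1 L f → Cond3 L f
      Cond1⇒Cond3 (A , f≈Lω) =
        List.length M , List.lookup M , (λ i → Accepts (threshold A (List.lookup M i))) ,
        (λ i → threshold A _ , λ w → id , id) ,
        λ w → Eq.trans (f≈Lω w) (Lω≈⋁threshold A M (runValue∈meets A) w)
        where
        M = meets (weights A)

      Cond3⇒Cond2 : Cond3 L f → Cond2 L f
      Cond3⇒Cond2 (k , m , Ls , regular , f≈) =
        (joins m Ls , λ w → Any.map (Eq.trans (f≈ w)) (⋁[]∈joins m Ls w)) ,
        λ w₀ → ωRegular-cong
          (λ w → ≤-resp-f w ∘ Equivalence.from (≤⋁[]⇔ m Ls w))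
          (λ w → Equivalence.to (≤⋁[]⇔ m Ls w) ∘ ≤-resp-f⁻¹ w)
          (Any-ωRegular (subsets k) λ p →
            guard×-ωRegular em (Π-ωRegular em λ i → guard→-ωRegular (i ∈ₛ? p) (regular i)))
        where
        ≤-resp-f : ∀ {a} w → a ≤ ⋁[ (λ i → Ls i w) ] m → a ≤ f w
        ≤-resp-f w a≤ = ≤ᴸ-trans a≤ (reflexive (Eq.sym (f≈ w)))
        ≤-resp-f⁻¹ : ∀ {a} w → a ≤ f w → a ≤ ⋁[ (λ i → Ls i w) ] m
        ≤-resp-f⁻¹ w a≤ = ≤ᴸ-trans a≤ (reflexive (f≈ w))

      Cond2⇒Cond3 : Cond2 L f → Cond3 L f
      Cond2⇒Cond3 ((xs , finite) , regular) =
        List.length xs , List.lookup xs , (λ i → Accepts (cut i)) , (λ i → cut i , λ w → id , id) ,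
        λ w → antisym
          (let fw≈xᵢ = lookup-index (finite w)
           in ≤ᴸ-trans (reflexive fw≈xᵢ)
                       (⋁-upper _ (lift (Any.index (finite w) , attained-accepted _ w fw≈xᵢ))))
          (⋁-least _ _ λ { (lift (i , acc)) → accepted-above i w acc })
        where
        CutAutomaton : Fin (List.length xs) → Set _
        CutAutomaton i = Σ (Buchi s) λ B → (∀ w → f w ≈ List.lookup xs i → Accepts B w)
                                          × (∀ w → Accepts B w → List.lookup xs i ≤ f w)
        cutAutomaton : ∀ i → CutAutomaton i
        cutAutomaton i with em {P = ∃ λ w₀ → f w₀ ≈ List.lookup xs i}
        ... | yes (w₀ , fw₀≈xᵢ) =
          let B , rec = regular w₀ in
          B , (λ w fw≈xᵢ → proj₁ (rec w) (reflexive (Eq.trans fw₀≈xᵢ (Eq.sym fw≈xᵢ)))) ,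
              (λ w acc → ≤ᴸ-trans (reflexive (Eq.sym fw₀≈xᵢ)) (proj₂ (rec w) acc))
        ... | no unattained =
          let B , rec = ∅-ωRegular in
          B , (λ w fw≈xᵢ → ⊥-elim (unattained (w , fw≈xᵢ))) ,
              (λ w acc → ⊥-elim (proj₂ (rec w) acc))
        cut : Fin (List.length xs) → Buchi s
        cut = proj₁ ∘ cutAutomaton
        attained-accepted : ∀ i w → f w ≈ List.lookup xs i → Accepts (cut i) w
        attained-accepted = proj₁ ∘ proj₂ ∘ cutAutomaton
        accepted-above : ∀ i w → Accepts (cut i) w → List.lookup xs i ≤ f w
        accepted-above = proj₂ ∘ proj₂ ∘ cutAutomaton

      Cond3⇒Cond1 : Cond3 L f → Cond1 L f
      Cond3⇒Cond1 (k , m , Ls , regular , f≈) =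
        ⋁ᴬ m B , λ w → Eq.trans (f≈ w) (Eq.trans
          (⋁[]-cong m (λ i → proj₁ (proj₂ (regular i) w)) (λ i → proj₂ (proj₂ (regular i) w)))
          (Eq.sym (Lω-⋁ᴬ m B w)))
        where
        B = proj₁ ∘ regular

proposition9 : (em : ∀ {ℓ} → ExcludedMiddle ℓ)
               → ∀ {c ℓ₁ ℓ₂} (L : CompleteDistributiveLattice c ℓ₁ ℓ₂) (s : ℕ)
               → (f : Word s → CompleteDistributiveLattice.Carrier L)
               → ((Cond1 L f → Cond2 L f) × (Cond2 L f → Cond1 L f))
                 × ((Cond2 L f → Cond3 L f) × (Cond3 L f → Cond2 L f))
proposition9 em L s f =
  (Cond3⇒Cond2 L em ∘ Cond1⇒Cond3 L em , Cond3⇒Cond1 L em ∘ Cond2⇒Cond3 L em) ,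
  (Cond2⇒Cond3 L em , Cond3⇒Cond2 L em)
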